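{- Let $\widetilde{\Sigma}$ be a $K$-stack call-return alphabet and $\mathcal{L}\subseteq\mathbb{NW}(\widetilde{\Sigma})$. The following are equivalent: (1) there is an MVPA $\mathcal{A}$ over $\widetilde{\Sigma}$ with $\mathcal{L}(\mathcal{A})=\mathcal{L}$; (2) there is an MNWA $\mathcal{B}$ over $\widetilde{\Sigma}$ with $\mathcal{L}(\mathcal{B})=\mathcal{L}$.
   Context: For $n\in\mathbb{N}$ let $[n]=\{1,\dots,n\}$. A $K$-stack call-return alphabet is $\widetilde{\Sigma}=\langle\{(\Sigma_c^s,\Sigma_r^s)\}_{s\in[K]},\Sigma_{int}\rangle$ of pairwise disjoint finite sets; $\Sigma_c=\bigcup_s\Sigma_c^s$, $\Sigma_r=\bigcup_s\Sigma_r^s$, $\Sigma=\Sigma_c\cup\Sigma_r\cup\Sigma_{int}$. An MVPA over $\widetilde{\Sigma}$ is $\mathcal{A}=(Q,\Gamma,\delta,Q_I,F)$ with finite $Q$, $Q_I,F\subseteq Q$, finite stack alphabet $\Gamma\ni\bot$, $\delta=\langle\delta_c,\delta_r,\delta_{int}\rangle$, $\delta_c\subseteq Q\times\Sigma_c\times(\Gamma\setminus\{\bot\})\times Q$, $\delta_r\subseteq Q\times\Sigma_r\times\Gamma\times Q$, $\delta_{int}\subseteq Q\times\Sigma_{int}\times Q$. A run on $w=a_1\dots a_n\in\Sigma^+$ is a sequence of configurations $(q_i,\sigma_i^1,\dots,\sigma_i^K)$, $i=0..n$, with stack contents in $(\Gamma\setminus\{\bot\})^*\bot$ (top leftmost),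 $q_0\in Q_I$, $\sigma_0^s=\bot$, and for each $i$: if $a_i\in\Sigma_c^s$, some $(q_{i-1},a_i,A,q_i)\in\delta_c$ with $\sigma_i^s=A\sigma_{i-1}^s$; if $a_i\in\Sigma_r^s$, some $(q_{i-1},a_i,A,q_i)\in\delta_r$ where either $A\ne\bot$ and $\sigma_{i-1}^s=A\sigma_i^s$, or $A=\bot$ and $\sigma_{i-1}^s=\sigma_i^s=\bot$; if $a_i\in\Sigma_{int}$, $(q_{i-1},a_i,q_i)\in\delta_{int}$; all other stacks unchanged. Accepting if $q_n\in F$; $L(\mathcal{A})$ is the set of accepted strings. A string is $s$-well formed if generated by $A::=aAb\mid AA\mid\varepsilon\mid c$, $a\in\Sigma_c^s$, $b\in\Sigma_r^s$, $c\in\Sigma\setminus(\Sigma_c^s\cup\Sigma_r^s)$. A nested word is $([n],\lessdot,\mu,\lambda)$, $n\ge1$, $\lessdot=\{(i,i+1)\}$, $\lambda:[n]\to\Sigma$, $\mu=\bigcup_s\mu^s$ with $(i,j)\in\mu^s$ iff $i<j$, $\lambda(i)\in\Sigma_c^s$, $\lambda(j)\in\Sigma_r^s$, $\lambda(i+1)\dots\lambda(j-1)$ $s$-well formed; $\mathbb{NW}(\widetilde{\Sigma})$ is the set of nested words, $\mathrm{nested}(w)$ the unique nested word with label sequence $w$, and $\mathcal{L}(\mathcal{A})=\{\mathrm{nested}(w)\mid w\in L(\mathcal{A})\}$. Write $\mu^{ -1}(j)=i$ when $(i,j)\in\mu$. An MNWA over $\widetilde{\Sigma}$ is $\mathcal{B}=(Q,\delta,Q_I,F)$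 with finite $Q$, $Q_I,F\subseteq Q$, $\delta=\langle\delta_1,\delta_2\rangle$, $\delta_1\subseteq Q\times\Sigma\times Q$, $\delta_2\subseteq Q\times Q\times\Sigma_r\times Q$. A run on $([n],\lessdot,\mu,\lambda)$ is $\rho:[n]\to Q$ with $(q,\lambda(1),\rho(1))\in\delta_1$ for some $q\in Q_I$ and for $i\ge2$: $(\rho(\mu^{ -1}(i)),\rho(i-1),\lambda(i),\rho(i))\in\delta_2$ if $\mu^{ -1}(i)$ is defined, else $(\rho(i-1),\lambda(i),\rho(i))\in\delta_1$. Accepting if $\rho(n)\in F$; $\mathcal{L}(\mathcal{B})$ is the set of nested words with an accepting run. -}

module Defs where

open import Data.Nat using (ℕ; zero; suc; _∸_; _<_)
open import Data.Fin using (Fin; toℕ; inject₁; fromℕ)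
open import Data.Bool using (Bool; T)
open import Data.Maybe using (Maybe; just; nothing)
open import Data.List using (List; []; _∷_; _++_; take; drop; length; lookup)
open import Data.List.NonEmpty using (List⁺; toList) renaming (_∷_ to _∷⁺_)
open import Data.Product using (Σ; _×_; ∃; ∃-syntax)
open import Data.Sum using (_⊎_)
open import Relation.Binary.PropositionalEquality using (_≡_; _≢_)
open import Relation.Nullary using (¬_)

-- K-stack call-return alphabets
-- The letter set is Fin m; `kind` assigns every letter to exactly one of
-- Σ_c^s, Σ_r^s (s ∈ [K], here Fin K) or Σ_int, which encodes that these
-- sets are pairwise disjoint finite sets whose union is Σ.

data Kind (K : ℕ) : Set where
  call : Fin K → Kind K
  ret  : Fin K → Kind K
  int  : Kind K

record Alphabet : Set where
  field
    K    : ℕ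
    m    : ℕ
    kind : Fin m → Kind K

  Letter : Set
  Letter = Fin m

module _ (Σ̃ : Alphabet) where
  open Alphabet Σ̃

  data WF (s : Fin K) : List Letter → Set where
    wf-nest : ∀ {a b u} → kind a ≡ call s → WF s u → kind b ≡ ret s →
              WF s (a ∷ (u ++ (b ∷ [])))
    wf-cat  : ∀ {u v} → WF s u → WF s v → WF s (u ++ v)
    wf-eps  : WF s []
    wf-sym  : ∀ {c} → kind c ≢ call s → kind c ≢ ret s → WF s (c ∷ [])

  -- A nested word ([n], ⋖, μ, λ) is determined by its (nonempty) label
  -- sequence λ(1)…λ(n); the matching relation μ is defined from it below.
  NestedWord : Set
  NestedWord = List⁺ Letter

  Pos : NestedWord → Set
  Pos w = Fin (length (toList w))

  label : (w : NestedWord) → Pos w → Letter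
  label w i = lookup (toList w) i

  between : (w : NestedWord) → Pos w → Pos w → List Letter
  between w i j = take (toℕ j ∸ suc (toℕ i)) (drop (suc (toℕ i)) (toList w))

  μˢ : (w : NestedWord) → Fin K → Pos w → Pos w → Set
  μˢ w s i j = (toℕ i < toℕ j) × (kind (label w i) ≡ call s)
             × (kind (label w j) ≡ ret s) × WF s (between w i j)

  μ : (w : NestedWord) → Pos w → Pos w → Set
  μ w i j = ∃[ s ] μˢ w s i j

  record MVPA : Set where
    field
      nQ   : ℕ
      nG   : ℕ          -- Γ = Maybe (Fin nG), with ⊥ = nothing
      δc   : Fin nQ → Letter → Fin nG → Fin nQ → Bool
      δr   : Fin nQ → Letter → Maybe (Fin nG) → Fin nQ → Bool
      δint : Fin nQ → Letter → Fin nQ → Bool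
      QI   : Fin nQ → Bool
      F    : Fin nQ → Bool

  module _ (A : MVPA) where
    open MVPA A

    -- a configuration: a state and K stacks; a stack content
    -- γ₁…γₖ⊥ ∈ (Γ∖{⊥})*⊥ is represented by the list γ₁ ∷ … ∷ γₖ ∷ []
    record Config : Set where
      constructor ⟨_,_⟩
      field
        state  : Fin nQ
        stacks : Fin K → List (Fin nG)
    open Config

    data Step : Config → Letter → Config → Set where
      step-call : ∀ {c a c' s A} → kind a ≡ call s →
        T (δc (state c) a A (state c')) →
        stacks c' s ≡ A ∷ stacks c s →
        (∀ t → t ≢ s → stacks c' t ≡ stacks c t) →
        Step c a c'
      step-ret : ∀ {c a c' s A} → kind a ≡ ret s →
        T (δr (state c) a (just A) (state c')) →
        stacks c s ≡ A ∷ stacks c' s →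
        (∀ t → t ≢ s → stacks c' t ≡ stacks c t) →
        Step c a c'
      step-ret⊥ : ∀ {c a c' s} → kind a ≡ ret s →
        T (δr (state c) a nothing (state c')) →
        stacks c s ≡ [] → stacks c' s ≡ [] →
        (∀ t → t ≢ s → stacks c' t ≡ stacks c t) →
        Step c a c'
      step-int : ∀ {c a c'} → kind a ≡ int →
        T (δint (state c) a (state c')) →
        (∀ t → stacks c' t ≡ stacks c t) →
        Step c a c'

    data Run : Config → List Letter → Config → Set where
      run-nil  : ∀ {c} → Run c [] c
      run-cons : ∀ {c a c' u c''} → Step c a c' → Run c' u c'' → Run c (a ∷ u) c''

    AcceptsMVPA : List⁺ Letter → Set
    AcceptsMVPA w = ∃[ q₀ ] ∃[ c ]
      (T (QI q₀) × Run ⟨ q₀ , (λ _ → []) ⟩ (toList w) c × T (F (state c)))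

  -- 𝓛(A) = { nested(w) | w ∈ L(A) }; nested(w) is the nested word with
  -- label sequence w
  𝓛ᴬ : MVPA → NestedWord → Set
  𝓛ᴬ A nw = AcceptsMVPA A nw

  record MNWA : Set where
    field
      nQ : ℕ
      δ₁ : Fin nQ → Letter → Fin nQ → Bool
      δ₂ : Fin nQ → Fin nQ → Letter → Fin nQ → Bool
      QI : Fin nQ → Bool
      F  : Fin nQ → Bool

  module _ (B : MNWA) where
    open MNWA B

    -- ρ is a run of B on the nested word w (positions 0-indexed)
    IsRunMNWA : (w : NestedWord) → (Pos w → Fin nQ) → Set
    IsRunMNWA w@(x ∷⁺ xs) ρ =
      (∃[ q ] (T (QI q) × T (δ₁ q (label w Data.Fin.zero) (ρ Data.Fin.zero))))
      × (∀ (i : Fin (length xs)) →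
           let j = Data.Fin.suc i in
           (∃[ k ] (μ w k j × T (δ₂ (ρ k) (ρ (inject₁ i)) (label w j) (ρ j))))
           ⊎ ((∀ k → ¬ μ w k j) × T (δ₁ (ρ (inject₁ i)) (label w j) (ρ j))))

    𝓛ᴮ : NestedWord → Set
    𝓛ᴮ w@(x ∷⁺ xs) = ∃[ ρ ] (IsRunMNWA w ρ × T (F (ρ (fromℕ (length xs)))))

-- An MVPA run is determined by its states and the symbols pushed at calls:
-- the content of stack s before position j is the sequence of symbols pushed
-- at the s-calls still pending before j.  An MNWA run is a sequence of states,
-- and the call matched with a return at j is exactly the most recent pending
-- call of its stack before j: cutting a prefix at its pending s-calls leaves
-- s-well formed segments after each of them.  So both acceptance conditions
-- become conditions at each position that mention only the calls pending
-- before it.  An MVPA that pushes the state reached at each call simulates an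
-- MNWA, and an MNWA whose states also record the symbol just pushed simulates
-- an MVPA.

module Submission where

open import Defs
open import Data.Nat using (ℕ; zero; suc; _+_; _*_; _∸_; _<_; z≤n; s≤s; _<?_)
open import Data.Nat.Properties using (+-suc; +-identityʳ; suc-injective)
open import Data.Fin using (Fin; toℕ; inject₁; fromℕ; fromℕ<; _≟_)
open import Data.Fin.Properties using (toℕ<n; fromℕ<-toℕ; toℕ-inject₁; toℕ-fromℕ; *↔×)
open import Data.List using (List; []; _∷_; _++_; _∷ʳ_; take; drop; length; lookup; head)
open import Data.Maybe using (Maybe; just; nothing; _>>=_)
import Data.Maybe as Maybe
open import Data.Bool using (Bool; T; false; _∧_)
open import Data.List.Relation.Binary.Pointwise using (Pointwise; []; _∷_)
open import Data.List.Properties using (++-assoc; ∷-injectiveʳ)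
open import Data.List.Reverse using (Reverse; reverseView; []; _∶_∶ʳ_)
open import Data.List.NonEmpty using (toList) renaming (_∷_ to _∷⁺_)
open import Data.Product using (_×_; ∃-syntax; _,_; proj₁; proj₂)
open import Data.Sum using (_⊎_; inj₁; inj₂)
open import Data.Empty using (⊥-elim)
open import Data.Unit using (⊤; tt)
open import Data.Vec.Functional using (updateAt)
open import Data.Vec.Functional.Properties using (updateAt-updates; updateAt-minimal)
open import Relation.Binary.PropositionalEquality
open import Relation.Nullary using (¬_; yes; no)
open import Relation.Nullary.Decidable using (⌊_⌋)
open import Function.Construct.Composition using (_⇔-∘_)
open import Function.Construct.Symmetry using (⇔-sym)
open import Function.Construct.Identity using (⇔-id)
open import Function.Bundles using (_⇔_; mk⇔; Equivalence; _↔_; Inverse)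
open import Function.Base using (_∘_; case_of_)

private variable
  X : Set

pop : List X → List X
pop = drop 1

infix 4 _[_]=_

data _[_]=_ {X : Set} : List X → ℕ → X → Set where
  here  : ∀ {x xs} → (x ∷ xs) [ 0 ]= x
  there : ∀ {x y xs e} → xs [ e ]= y → (x ∷ xs) [ suc e ]= y

lookup⇒[]= : (xs : List X) (i : Fin (length xs)) → xs [ toℕ i ]= lookup xs i
lookup⇒[]= (x ∷ xs) Fin.zero    = here
lookup⇒[]= (x ∷ xs) (Fin.suc i) = there (lookup⇒[]= xs i)

[]=⇒lookup : ∀ {xs : List X} {e y} → xs [ e ]= y →
             ∃[ i ] (toℕ i ≡ e × lookup xs i ≡ y)
[]=⇒lookup here = Fin.zero , refl , refl
[]=⇒lookup (there p) with []=⇒lookup p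
... | i , refl , refl = Fin.suc i , refl , refl

++-∷-[]= : (xs : List X) (y : X) (ys : List X) → (xs ++ y ∷ ys) [ length xs ]= y
++-∷-[]= []       y ys = here
++-∷-[]= (x ∷ xs) y ys = there (++-∷-[]= xs y ys)

take-[]= : ∀ k (xs : List X) {e y} → take k xs [ e ]= y → e < k × xs [ e ]= y
take-[]= (suc k) (x ∷ xs) here      = s≤s z≤n , here
take-[]= (suc k) (x ∷ xs) (there p) with take-[]= k xs p
... | e<k , q = s≤s e<k , there q

[]=⇒length-take : ∀ {xs : List X} {k y} → xs [ k ]= y → length (take k xs) ≡ k
[]=⇒length-take here      = refl
[]=⇒length-take (there p) = cong suc ([]=⇒length-take p)

take-split : ∀ {xs : List X} {k y} j → xs [ k ]= y → k < j →
             take j xs ≡ take k xs ++ y ∷ take (j ∸ suc k) (drop (suc k) xs)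
take-split (suc j) here            (s≤s _)   = refl
take-split (suc j) (there {x = x} p) (s≤s k<j) = cong (x ∷_) (take-split j p k<j)

++-cancelˡ-length : ∀ (xs ys : List X) {zs zs′} → length xs ≡ length ys →
                    xs ++ zs ≡ ys ++ zs′ → zs ≡ zs′
++-cancelˡ-length []       []       _   eq = eq
++-cancelˡ-length (x ∷ xs) (y ∷ ys) len eq =
  ++-cancelˡ-length xs ys (suc-injective len) (∷-injectiveʳ eq)

extend : ∀ {n} → (Fin n → X) → X → ℕ → X
extend {n = n} ρ d m with m <? n
... | yes m<n = ρ (fromℕ< m<n)
... | no  _   = d

extend-toℕ : ∀ {n} (ρ : Fin n → X) d i → extend ρ d (toℕ i) ≡ ρ i
extend-toℕ {n = n} ρ d i with toℕ i <? n
... | yes i<n = cong ρ (fromℕ<-toℕ i i<n)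
... | no  i≮n = ⊥-elim (i≮n (toℕ<n i))

toMaybe : ∀ {n} → Fin (suc n) → Maybe (Fin n)
toMaybe Fin.zero    = nothing
toMaybe (Fin.suc i) = just i

fromMaybe : ∀ {n} → Maybe (Fin n) → Fin (suc n)
fromMaybe nothing  = Fin.zero
fromMaybe (just i) = Fin.suc i

toMaybe-fromMaybe : ∀ {n} (g : Maybe (Fin n)) → toMaybe (fromMaybe g) ≡ g
toMaybe-fromMaybe nothing  = refl
toMaybe-fromMaybe (just _) = refl

module _ (Σ̃ : Alphabet) where
  open Alphabet Σ̃

  -- Pending calls

  -- For each stack, the positions of its pending calls, most recent first.
  Pending : Set
  Pending = Fin K → List ℕ

  call-injective : ∀ {s t} → call {K} s ≡ call t → s ≡ t
  call-injective refl = refl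

  ret-injective : ∀ {s t} → ret {K} s ≡ ret t → s ≡ t
  ret-injective refl = refl

  onStack : Fin K → ℕ → Kind K → List ℕ → List ℕ
  onStack t p (call s) ks with s ≟ t
  ... | yes _ = p ∷ ks
  ... | no  _ = ks
  onStack t p (ret s) ks with s ≟ t
  ... | yes _ = pop ks
  ... | no  _ = ks
  onStack t p int ks = ks

  onStack-call : ∀ s p ks → onStack s p (call s) ks ≡ p ∷ ks
  onStack-call s p ks with s ≟ s
  ... | yes _   = refl
  ... | no  s≢s = ⊥-elim (s≢s refl)

  onStack-ret : ∀ s p ks → onStack s p (ret s) ks ≡ pop ks
  onStack-ret s p ks with s ≟ s
  ... | yes _   = refl
  ... | no  s≢s = ⊥-elim (s≢s refl)

  onStack-neutral : ∀ {s} kd p ks → kd ≢ call s → kd ≢ ret s → onStack s p kd ks ≡ ks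
  onStack-neutral {s} (call t) p ks ≢call _ with t ≟ s
  ... | yes refl = ⊥-elim (≢call refl)
  ... | no  _    = refl
  onStack-neutral {s} (ret t) p ks _ ≢ret with t ≟ s
  ... | yes refl = ⊥-elim (≢ret refl)
  ... | no  _    = refl
  onStack-neutral int p ks _ _ = refl

  onStack-call-other : ∀ {s t} p ks → t ≢ s → onStack t p (call s) ks ≡ ks
  onStack-call-other p ks t≢s = onStack-neutral _ p ks (t≢s ∘ sym ∘ call-injective) λ ()

  onStack-ret-other : ∀ {s t} p ks → t ≢ s → onStack t p (ret s) ks ≡ ks
  onStack-ret-other p ks t≢s = onStack-neutral _ p ks (λ ()) (t≢s ∘ sym ∘ ret-injective)

  wf-neutral : ∀ {s c kd} → kind c ≡ kd → kd ≢ call s → kd ≢ ret s → WF Σ̃ s (c ∷ [])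
  wf-neutral kc ≢call ≢ret = wf-sym (≢call ∘ trans (sym kc)) (≢ret ∘ trans (sym kc))

  stepPending : ℕ → Letter → Pending → Pending
  stepPending p a S t = onStack t p (kind a) (S t)

  stepPending-kind : ∀ {p a kd} S t → kind a ≡ kd → stepPending p a S t ≡ onStack t p kd (S t)
  stepPending-kind {p} S t ka = cong (λ kd → onStack t p kd (S t)) ka

  -- p is the position of the first letter of u.
  pendingFrom : ℕ → Pending → List Letter → Pending
  pendingFrom p S []      = S
  pendingFrom p S (a ∷ u) = pendingFrom (suc p) (stepPending p a S) u

  pendingCalls : List Letter → Pending
  pendingCalls = pendingFrom 0 (λ _ → [])

  pendingFrom-++ : ∀ p S u v →
    pendingFrom p S (u ++ v) ≡ pendingFrom (p + length u) (pendingFrom p S u) v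
  pendingFrom-++ p S [] v = cong (λ p′ → pendingFrom p′ S v) (sym (+-identityʳ p))
  pendingFrom-++ p S (a ∷ u) v = begin
    pendingFrom (suc p) (stepPending p a S) (u ++ v)
      ≡⟨ pendingFrom-++ (suc p) _ u v ⟩
    pendingFrom (suc p + length u) (pendingFrom (suc p) (stepPending p a S) u) v
      ≡⟨ cong (λ p′ → pendingFrom p′ (pendingFrom (suc p) (stepPending p a S) u) v)
              (sym (+-suc p (length u))) ⟩
    pendingFrom (p + suc (length u)) (pendingFrom (suc p) (stepPending p a S) u) v ∎
    where open ≡-Reasoning

  pendingCalls-∷ʳ : ∀ u a t →
    pendingCalls (u ∷ʳ a) t ≡ onStack t (length u) (kind a) (pendingCalls u t)
  pendingCalls-∷ʳ u a t = cong-app (pendingFrom-++ 0 _ u (a ∷ [])) t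

  wf-pending : ∀ {s u} → WF Σ̃ s u → ∀ p S → pendingFrom p S u s ≡ S s
  wf-pending {s} (wf-nest {a} {b} {u} ka wu kb) p S = begin
    pendingFrom (suc p) (stepPending p a S) (u ++ b ∷ []) s
      ≡⟨ cong-app (pendingFrom-++ (suc p) _ u (b ∷ [])) s ⟩
    onStack s (suc p + length u) (kind b) (pendingFrom (suc p) (stepPending p a S) u s)
      ≡⟨ cong₂ (onStack s _) kb (wf-pending wu (suc p) _) ⟩
    onStack s (suc p + length u) (ret s) (onStack s p (kind a) (S s))
      ≡⟨ cong (onStack s (suc p + length u) (ret s)) (trans (stepPending-kind S s ka) (onStack-call s p (S s))) ⟩
    onStack s (suc p + length u) (ret s) (p ∷ S s)
      ≡⟨ onStack-ret s (suc p + length u) (p ∷ S s) ⟩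
    S s ∎
    where open ≡-Reasoning
  wf-pending {s} (wf-cat {u} {v} wu wv) p S = begin
    pendingFrom p S (u ++ v) s                       ≡⟨ cong-app (pendingFrom-++ p S u v) s ⟩
    pendingFrom (p + length u) (pendingFrom p S u) v s ≡⟨ wf-pending wv (p + length u) (pendingFrom p S u) ⟩
    pendingFrom p S u s                              ≡⟨ wf-pending wu p S ⟩
    S s ∎
    where open ≡-Reasoning
  wf-pending wf-eps p S = refl
  wf-pending (wf-sym {c} ≢call ≢ret) p S = onStack-neutral (kind c) p _ ≢call ≢ret

  pendingCalls-matched : ∀ {s u c v} → kind c ≡ call s → WF Σ̃ s v →
    pendingCalls (u ++ c ∷ v) s ≡ length u ∷ pendingCalls u s
  pendingCalls-matched {s} {u} {c} {v} kc wv = begin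
    pendingCalls (u ++ c ∷ v) s
      ≡⟨ cong-app (pendingFrom-++ 0 _ u (c ∷ v)) s ⟩
    pendingFrom (suc (length u)) (stepPending (length u) c (pendingCalls u)) v s
      ≡⟨ wf-pending wv (suc (length u)) (stepPending (length u) c (pendingCalls u)) ⟩
    onStack s (length u) (kind c) (pendingCalls u s)
      ≡⟨ stepPending-kind (pendingCalls u) s kc ⟩
    onStack s (length u) (call s) (pendingCalls u s)
      ≡⟨ onStack-call s _ _ ⟩
    length u ∷ pendingCalls u s ∎
    where open ≡-Reasoning

  -- Matching calls

  -- u = u₀ c₁ v₁ ⋯ cₙ vₙ where the cᵢ are the s-calls at the positions ks
  -- (top first) and every vᵢ is s-well formed.
  data OpenCalls (s : Fin K) : List Letter → List ℕ → Set where
    closed : ∀ {u} → pendingCalls u s ≡ [] → OpenCalls s u []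
    opened : ∀ {u c v ks} → OpenCalls s u ks → kind c ≡ call s → WF Σ̃ s v →
             OpenCalls s (u ++ c ∷ v) (length u ∷ ks)

  openCalls-++ : ∀ {s u ks x} → OpenCalls s u ks → WF Σ̃ s x → OpenCalls s (u ++ x) ks
  openCalls-++ {s} {u} {x = x} (closed eq) wx =
    closed (trans (cong-app (pendingFrom-++ 0 _ u x) s)
                  (trans (wf-pending wx (length u) (pendingCalls u)) eq))
  openCalls-++ {x = x} (opened {u} {c} {v} d kc wv) wx =
    subst (λ u′ → OpenCalls _ u′ _) (sym (++-assoc u (c ∷ v) x)) (opened d kc (wf-cat wv wx))

  openCalls-ret : ∀ {s u ks b} → OpenCalls s u ks → kind b ≡ ret s → OpenCalls s (u ∷ʳ b) (pop ks)
  openCalls-ret {s} {u} {b = b} (closed eq) kb = closed (begin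
    pendingCalls (u ∷ʳ b) s                    ≡⟨ pendingCalls-∷ʳ u b s ⟩
    onStack s (length u) (kind b) (pendingCalls u s) ≡⟨ cong₂ (onStack s (length u)) kb eq ⟩
    onStack s (length u) (ret s) []             ≡⟨ onStack-ret s (length u) [] ⟩
    [] ∎)
    where open ≡-Reasoning
  openCalls-ret {b = b} (opened {u} {c} {v} d kc wv) kb =
    subst (λ u′ → OpenCalls _ u′ _) (sym (++-assoc u (c ∷ v) (b ∷ []))) (openCalls-++ d (wf-nest kc wv kb))

  openCalls-∷ʳ : ∀ {s u ks a} kd → kind a ≡ kd → OpenCalls s u ks →
                 OpenCalls s (u ∷ʳ a) (onStack s (length u) kd ks)
  openCalls-∷ʳ {s} (call t) ka d with t ≟ s
  ... | yes refl = opened d ka wf-eps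
  ... | no  t≢s  = openCalls-++ d (wf-neutral ka (t≢s ∘ call-injective) λ ())
  openCalls-∷ʳ {s} (ret t) ka d with t ≟ s
  ... | yes refl = openCalls-ret d ka
  ... | no  t≢s  = openCalls-++ d (wf-neutral ka (λ ()) (t≢s ∘ ret-injective))
  openCalls-∷ʳ int ka d = openCalls-++ d (wf-neutral ka (λ ()) (λ ()))

  openCalls : ∀ s u → OpenCalls s u (pendingCalls u s)
  openCalls s u = go (reverseView u)
    where
    go : ∀ {u} → Reverse u → OpenCalls s u (pendingCalls u s)
    go []            = closed refl
    go (u ∶ r ∶ʳ a) =
      subst (OpenCalls s (u ∷ʳ a)) (sym (pendingCalls-∷ʳ u a s)) (openCalls-∷ʳ (kind a) refl (go r))

  topOpenCall : ∀ {s u k ks} → OpenCalls s u (k ∷ ks) →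
    ∃[ u₀ ] ∃[ c ] ∃[ v ] (u ≡ u₀ ++ c ∷ v × length u₀ ≡ k × kind c ≡ call s × WF Σ̃ s v)
  topOpenCall (opened {u₀} {c} {v} _ kc wv) = u₀ , c , v , refl , refl , kc , wv

  matched⇒pendingTop : ∀ {ws s i c} j → ws [ i ]= c → i < j → kind c ≡ call s →
    WF Σ̃ s (take (j ∸ suc i) (drop (suc i) ws)) →
    pendingCalls (take j ws) s ≡ i ∷ pendingCalls (take i ws) s
  matched⇒pendingTop {ws} {s} {i} j at i<j kc wf = begin
    pendingCalls (take j ws) s
      ≡⟨ cong (λ u → pendingCalls u s) (take-split j at i<j) ⟩
    pendingCalls (take i ws ++ _ ∷ take (j ∸ suc i) (drop (suc i) ws)) s
      ≡⟨ pendingCalls-matched {u = take i ws} kc wf ⟩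
    length (take i ws) ∷ pendingCalls (take i ws) s
      ≡⟨ cong (_∷ pendingCalls (take i ws) s) ([]=⇒length-take at) ⟩
    i ∷ pendingCalls (take i ws) s ∎
    where open ≡-Reasoning

  pendingTop⇒matched : ∀ {ws s i r} j → pendingCalls (take j ws) s ≡ i ∷ r →
    ∃[ c ] (i < j × ws [ i ]= c × kind c ≡ call s × WF Σ̃ s (take (j ∸ suc i) (drop (suc i) ws)))
  pendingTop⇒matched {ws} {s} j eq
    with topOpenCall (subst (OpenCalls s (take j ws)) eq (openCalls s (take j ws)))
  ... | u₀ , c , v , split , refl , kc , wv
    with take-[]= j ws (subst (_[ length u₀ ]= c) (sym split) (++-∷-[]= u₀ c v))
  ... | i<j , at = c , i<j , at , kc , subst (WF Σ̃ s) v≡between wv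
    where
    v≡between : v ≡ take (j ∸ suc (length u₀)) (drop (suc (length u₀)) ws)
    v≡between = ∷-injectiveʳ (++-cancelˡ-length u₀ (take (length u₀) ws)
                  (sym ([]=⇒length-take at)) (trans (sym split) (take-split j at i<j)))

  matchingCall : Pending → Letter → Maybe ℕ
  matchingCall S a with kind a
  ... | call _ = nothing
  ... | ret s  = head (S s)
  ... | int    = nothing

  matchingCall-ret : ∀ {S a s} → kind a ≡ ret s → matchingCall S a ≡ head (S s)
  matchingCall-ret ka rewrite ka = refl

  pendingAt : (w : NestedWord Σ̃) → Pos Σ̃ w → Pending
  pendingAt w j = pendingCalls (take (toℕ j) (toList w))

  μ⇒matchingCall : ∀ {w i j} → μ Σ̃ w i j →
    matchingCall (pendingAt w j) (label Σ̃ w j) ≡ just (toℕ i)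
  μ⇒matchingCall {w} {i} {j} (s , i<j , ki , kj , wf) =
    trans (matchingCall-ret kj)
          (cong head (matched⇒pendingTop (toℕ j) (lookup⇒[]= (toList w) i) i<j ki wf))

  matchingCall⇒μ : ∀ {w j k} → matchingCall (pendingAt w j) (label Σ̃ w j) ≡ just k →
    ∃[ i ] (toℕ i ≡ k × μ Σ̃ w i j)
  matchingCall⇒μ {w} {j} eq with kind (label Σ̃ w j)
  ... | ret s with pendingAt w j s in top
  ...   | _ ∷ _ with eq
  ...     | refl with pendingTop⇒matched (toℕ j) top
  ...       | c , i<j , at , kc , wf with []=⇒lookup at
  ...         | i , refl , refl = i , refl , s , i<j , kc , refl , wf

  -- Runs as labellings of positions

  -- A condition on a position, the calls pending before it and its letter.
  Local : Set₁
  Local = ℕ → Pending → Letter → Set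

  Along : Local → ℕ → Pending → List Letter → Set
  Along L p S []      = ⊤
  Along L p S (a ∷ u) = L p S a × Along L (suc p) (stepPending p a S) u

  Everywhere : Local → List Letter → Set
  Everywhere L ws = (j : Fin (length ws)) → L (toℕ j) (pendingCalls (take (toℕ j) ws)) (lookup ws j)

  along⇒at : ∀ {L p S} u → Along L p S u → (j : Fin (length u)) →
             L (p + toℕ j) (pendingFrom p S (take (toℕ j) u)) (lookup u j)
  along⇒at {L} {p} {S} (a ∷ u) (l , _) Fin.zero =
    subst (λ p′ → L p′ S a) (sym (+-identityʳ p)) l
  along⇒at {L} {p} {S} (a ∷ u) (_ , r) (Fin.suc j) =
    subst (λ p′ → L p′ (pendingFrom (suc p) (stepPending p a S) (take (toℕ j) u)) (lookup u j))
          (sym (+-suc p (toℕ j))) (along⇒at u r j)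

  at⇒along : ∀ {L p S} u → ((j : Fin (length u)) →
             L (p + toℕ j) (pendingFrom p S (take (toℕ j) u)) (lookup u j)) → Along L p S u
  at⇒along []      _ = tt
  at⇒along {L} {p} {S} (a ∷ u) h =
    subst (λ p′ → L p′ S a) (+-identityʳ p) (h Fin.zero) ,
    at⇒along u (λ j →
      subst (λ p′ → L p′ (pendingFrom (suc p) (stepPending p a S) (take (toℕ j) u)) (lookup u j))
            (+-suc p (toℕ j)) (h (Fin.suc j)))

  -- q 0 is the initial state and q (suc p) the state after position p.
  Accepting : ∀ {n} → (Fin n → Bool) → (Fin n → Bool) → (ℕ → Fin n) → Local → List Letter → Set
  Accepting I F q L ws = T (I (q 0)) × Everywhere L ws × T (F (q (length ws)))

  module MVPARuns (A : MVPA Σ̃) where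
    open MVPA A
    open Config

    Stores : (ℕ → Maybe (Fin nG)) → List ℕ → List (Fin nG) → Set
    Stores γ = Pointwise (λ k G → γ k ≡ just G)

    Represents : (ℕ → Maybe (Fin nG)) → Pending → (Fin K → List (Fin nG)) → Set
    Represents γ S stk = ∀ t → Stores γ (S t) (stk t)

    stores-head : ∀ {γ ks st} → Stores γ ks st → (head ks >>= γ) ≡ head st
    stores-head []      = refl
    stores-head (γk ∷ _) = γk

    stores-pop : ∀ {γ ks st} → Stores γ ks st → Stores γ (pop ks) (pop st)
    stores-pop []      = []
    stores-pop (_ ∷ r) = r

    represents-at : ∀ {γ S S′ stk stk′} s → Represents γ S stk → Stores γ (S′ s) (stk′ s) →
      (∀ t → t ≢ s → S′ t ≡ S t) → (∀ t → t ≢ s → stk′ t ≡ stk t) → Represents γ S′ stk′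
    represents-at {γ} s rep at-s S-same stk-same t with t ≟ s
    ... | yes refl = at-s
    ... | no  t≢s  = subst₂ (Stores γ) (sym (S-same t t≢s)) (sym (stk-same t t≢s)) (rep t)

    -- γ p is the symbol pushed at position p, if p is a call.
    localA : (ℕ → Fin nQ) → (ℕ → Maybe (Fin nG)) → Local
    localA q γ p S a with kind a
    ... | call _ = ∃[ G ] (γ p ≡ just G × T (δc (q p) a G (q (suc p))))
    ... | ret s  = T (δr (q p) a (head (S s) >>= γ) (q (suc p)))
    ... | int    = T (δint (q p) a (q (suc p)))

    localA-call : ∀ {q γ p S a s} → kind a ≡ call s → localA q γ p S a →
      ∃[ G ] (γ p ≡ just G × T (δc (q p) a G (q (suc p))))
    localA-call ka l rewrite ka = l

    pushed : ∀ {c a c′} → Step Σ̃ A c a c′ → Maybe (Fin nG)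
    pushed (step-call {A = G} _ _ _ _) = just G
    pushed _                          = nothing

    T-cong₂ : ∀ (f : Fin nQ → Fin nQ → Bool) {x x′ y y′} → x ≡ x′ → y ≡ y′ → T (f x y) → T (f x′ y′)
    T-cong₂ f refl refl t = t

    step⇒localA : ∀ {q γ p S c a c′} (st : Step Σ̃ A c a c′) →
      state c ≡ q p → state c′ ≡ q (suc p) → γ p ≡ pushed st → Represents γ S (stacks c) →
      localA q γ p S a
    step⇒localA {a = a} (step-call {A = G} ka d _ _) eq eq′ γp _ rewrite ka =
      G , γp , T-cong₂ (λ x y → δc x a G y) eq eq′ d
    step⇒localA {q} {γ} {p} {S} {c} {a} (step-ret {s = s} {A = G} ka d popped _) eq eq′ _ rep rewrite ka =
      subst (λ g → T (δr (q p) a g (q (suc p))))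
            (sym (trans (stores-head (rep s)) (cong head popped)))
            (T-cong₂ (λ x y → δr x a (just G) y) eq eq′ d)
    step⇒localA {q} {γ} {p} {S} {c} {a} (step-ret⊥ {s = s} ka d empty _ _) eq eq′ _ rep rewrite ka =
      subst (λ g → T (δr (q p) a g (q (suc p))))
            (sym (trans (stores-head (rep s)) (cong head empty)))
            (T-cong₂ (λ x y → δr x a nothing y) eq eq′ d)
    step⇒localA {a = a} (step-int ka d _) eq eq′ _ _ rewrite ka =
      T-cong₂ (λ x y → δint x a y) eq eq′ d

    step⇒represents : ∀ {γ p S c a c′} (st : Step Σ̃ A c a c′) → γ p ≡ pushed st →
      Represents γ S (stacks c) → Represents γ (stepPending p a S) (stacks c′)
    step⇒represents {γ} {p} {S} (step-call {s = s} ka _ pushes same) γp rep =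
      represents-at s rep
        (subst₂ (Stores γ) (sym (trans (stepPending-kind S s ka) (onStack-call s p (S s)))) (sym pushes)
                (γp ∷ rep s))
        (λ t t≢s → trans (stepPending-kind S t ka) (onStack-call-other p (S t) t≢s)) same
    step⇒represents {γ} {p} {S} (step-ret {s = s} ka _ popped same) _ rep =
      represents-at s rep
        (subst (λ ks → Stores γ ks _) (sym (trans (stepPending-kind S s ka) (onStack-ret s p (S s))))
               (stores-pop (subst (Stores γ (S s)) popped (rep s))))
        (λ t t≢s → trans (stepPending-kind S t ka) (onStack-ret-other p (S t) t≢s)) same
    step⇒represents {γ} {p} {S} (step-ret⊥ {s = s} ka _ empty empty′ same) _ rep =
      represents-at s rep
        (subst₂ (Stores γ) (sym (trans (stepPending-kind S s ka) (onStack-ret s p (S s)))) (sym empty′)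
                (stores-pop (subst (Stores γ (S s)) empty (rep s))))
        (λ t t≢s → trans (stepPending-kind S t ka) (onStack-ret-other p (S t) t≢s)) same
    step⇒represents {γ} {S = S} (step-int ka _ same) _ rep t =
      subst₂ (Stores γ) (sym (stepPending-kind S t ka)) (sym (same t)) (rep t)

    localA⇒step : ∀ {q γ p S stk} a → localA q γ p S a → Represents γ S stk →
      ∃[ stk′ ] (Step Σ̃ A ⟨ q p , stk ⟩ a ⟨ q (suc p) , stk′ ⟩ × Represents γ (stepPending p a S) stk′)
    localA⇒step {q} {γ} {p} {S} {stk} a l rep with kind a in ka
    ... | int   = stk , step-int ka l (λ _ → refl) , rep
    ... | ret s =
      updateAt stk s pop , retStep ,
      represents-at s rep
        (subst₂ (Stores γ) (sym (onStack-ret s p (S s))) (sym popped) (stores-pop (rep s)))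
        (λ t → onStack-ret-other p (S t)) unchanged
      where
      popping : ∀ {st} → stk s ≡ st → T (δr (q p) a (head st) (q (suc p)))
      popping stk-s = subst (λ g → T (δr (q p) a g (q (suc p)))) (trans (stores-head (rep s)) (cong head stk-s)) l
      popped : updateAt stk s pop s ≡ pop (stk s)
      popped = updateAt-updates s stk
      unchanged : ∀ t → t ≢ s → updateAt stk s pop t ≡ stk t
      unchanged t = updateAt-minimal t s stk
      retStep : Step Σ̃ A ⟨ q p , stk ⟩ a ⟨ q (suc p) , updateAt stk s pop ⟩
      retStep with stk s in stk-s
      ... | []     = step-ret⊥ ka (popping stk-s) stk-s (trans popped (cong pop stk-s)) unchanged
      ... | G ∷ st = step-ret ka (popping stk-s)
                       (trans stk-s (cong (G ∷_) (sym (trans popped (cong pop stk-s))))) unchanged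
    ... | call s with l
    ...   | G , γp , d =
      updateAt stk s (G ∷_) , step-call ka d (updateAt-updates s stk) (λ t → updateAt-minimal t s stk) ,
      represents-at s rep
        (subst₂ (Stores γ) (sym (onStack-call s p (S s))) (sym (updateAt-updates s stk)) (γp ∷ rep s))
        (λ t → onStack-call-other p (S t)) (λ t → updateAt-minimal t s stk)

    statesOf : ∀ {c u c′} → Run Σ̃ A c u c′ → ℕ → Fin nQ
    statesOf {c} run-nil        _       = state c
    statesOf {c} (run-cons _ _) zero    = state c
    statesOf     (run-cons _ r) (suc i) = statesOf r i

    pushesOf : ∀ {c u c′} → Run Σ̃ A c u c′ → ℕ → Maybe (Fin nG)
    pushesOf run-nil         _       = nothing
    pushesOf (run-cons st _) zero    = pushed st
    pushesOf (run-cons _ r)  (suc i) = pushesOf r i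

    statesOf-zero : ∀ {c u c′} (r : Run Σ̃ A c u c′) → statesOf r 0 ≡ state c
    statesOf-zero run-nil        = refl
    statesOf-zero (run-cons _ _) = refl

    run⇒along : ∀ {q γ p S c u c′} (r : Run Σ̃ A c u c′) →
      (∀ i → q (p + i) ≡ statesOf r i) → (∀ i → γ (p + i) ≡ pushesOf r i) →
      Represents γ S (stacks c) → Along (localA q γ) p S u × q (p + length u) ≡ state c′
    run⇒along run-nil hq _ _ = tt , hq 0
    run⇒along {q} {γ} {p} {S} {c} {a ∷ u} {c″} (run-cons {c' = c′} st r) hq hγ rep =
      (step⇒localA st q-p q-suc-p γp rep , proj₁ rest) , trans (cong q (+-suc p (length u))) (proj₂ rest)
      where
      hq′ : ∀ i → q (suc p + i) ≡ statesOf r i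
      hq′ i = trans (cong q (sym (+-suc p i))) (hq (suc i))
      hγ′ : ∀ i → γ (suc p + i) ≡ pushesOf r i
      hγ′ i = trans (cong γ (sym (+-suc p i))) (hγ (suc i))
      q-p : state c ≡ q p
      q-p = sym (trans (cong q (sym (+-identityʳ p))) (hq 0))
      q-suc-p : state c′ ≡ q (suc p)
      q-suc-p = sym (trans (cong q (sym (+-identityʳ (suc p)))) (trans (hq′ 0) (statesOf-zero r)))
      γp : γ p ≡ pushed st
      γp = trans (cong γ (sym (+-identityʳ p))) (hγ 0)
      rest : Along (localA q γ) (suc p) (stepPending p a S) u × q (suc p + length u) ≡ state c″
      rest = run⇒along r hq′ hγ′ (step⇒represents st γp rep)

    along⇒run : ∀ {q γ p S stk} u → Along (localA q γ) p S u → Represents γ S stk →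
      ∃[ c′ ] (Run Σ̃ A ⟨ q p , stk ⟩ u c′ × state c′ ≡ q (p + length u))
    along⇒run {q} {p = p} [] _ _ = _ , run-nil , cong q (sym (+-identityʳ p))
    along⇒run {q} {p = p} (a ∷ u) (l , ls) rep with localA⇒step a l rep
    ... | _ , st , rep′ with along⇒run u ls rep′
    ...   | c′ , r , final = c′ , run-cons st r , trans final (cong q (sym (+-suc p (length u))))

    𝓛ᴬ⇔Accepting : ∀ w → AcceptsMVPA Σ̃ A w ⇔ (∃[ q ] ∃[ γ ] Accepting QI F q (localA q γ) (toList w))
    𝓛ᴬ⇔Accepting w = mk⇔ to from
      where
      to : AcceptsMVPA Σ̃ A w → ∃[ q ] ∃[ γ ] Accepting QI F q (localA q γ) (toList w)
      to (_ , c , init , r , fin) with run⇒along {S = λ _ → []} r (λ _ → refl) (λ _ → refl) (λ _ → [])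
      ... | along , final =
        statesOf r , pushesOf r ,
        subst (T ∘ QI) (sym (statesOf-zero r)) init ,
        along⇒at (toList w) along ,
        subst (T ∘ F) (sym final) fin
      from : ∃[ q ] ∃[ γ ] Accepting QI F q (localA q γ) (toList w) → AcceptsMVPA Σ̃ A w
      from (q , γ , init , everywhere , fin)
        with along⇒run (toList w) (at⇒along (toList w) everywhere) (λ _ → [])
      ... | c′ , r , final = q 0 , c′ , init , r , subst (T ∘ F) (sym final) fin

  module MNWARuns (B : MNWA Σ̃) where
    open MNWA B

    -- h is the state reached at the matching call, if there is one.
    transition : Fin nQ → Letter → Maybe (Fin nQ) → Fin nQ → Bool
    transition q a (just h) q′ = δ₂ h q a q′
    transition q a nothing  q′ = δ₁ q a q′

    localB : (ℕ → Fin nQ) → Local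
    localB q p S a = T (transition (q p) a (Maybe.map (q ∘ suc) (matchingCall S a)) (q (suc p)))

    RunCondition : (w : NestedWord Σ̃) → (Pos Σ̃ w → Fin nQ) → Fin nQ → Pos Σ̃ w → Set
    RunCondition w ρ prev j =
      (∃[ k ] (μ Σ̃ w k j × T (δ₂ (ρ k) prev (label Σ̃ w j) (ρ j))))
      ⊎ ((∀ k → ¬ μ Σ̃ w k j) × T (δ₁ prev (label Σ̃ w j) (ρ j)))

    RunCondition⇔localB : ∀ {w} (q : ℕ → Fin nQ) (ρ : Pos Σ̃ w → Fin nQ) → (∀ i → q (suc (toℕ i)) ≡ ρ i) →
      ∀ j → RunCondition w ρ (q (toℕ j)) j ⇔ localB q (toℕ j) (pendingAt w j) (label Σ̃ w j)
    RunCondition⇔localB {w} q ρ q≡ρ j = mk⇔ to from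
      where
      a = label Σ̃ w j
      to : RunCondition w ρ (q (toℕ j)) j → localB q (toℕ j) (pendingAt w j) a
      to (inj₁ (k , m , d)) rewrite μ⇒matchingCall m =
        subst₂ (λ h q′ → T (δ₂ h (q (toℕ j)) a q′)) (sym (q≡ρ k)) (sym (q≡ρ j)) d
      to (inj₂ (unmatched , d)) with matchingCall (pendingAt w j) a in eq
      ... | just _  = ⊥-elim (let (i , _ , m) = matchingCall⇒μ eq in unmatched i m)
      ... | nothing = subst (λ q′ → T (δ₁ (q (toℕ j)) a q′)) (sym (q≡ρ j)) d
      from : localB q (toℕ j) (pendingAt w j) a → RunCondition w ρ (q (toℕ j)) j
      from l with matchingCall (pendingAt w j) a in eq
      ... | just _ with matchingCall⇒μ eq
      ...   | i , i≡k , m = inj₁ (i , m , subst₂ (λ h q′ → T (δ₂ h (q (toℕ j)) a q′))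
                                                (trans (cong (q ∘ suc) (sym i≡k)) (q≡ρ i)) (q≡ρ j) l)
      from l | nothing =
        inj₂ ((λ i m → case trans (sym (μ⇒matchingCall m)) eq of λ ()) ,
              subst (λ q′ → T (δ₁ (q (toℕ j)) a q′)) (q≡ρ j) l)

    RunCondition-zero : ∀ {x xs ρ prev} → RunCondition (x ∷⁺ xs) ρ prev Fin.zero ⇔ T (δ₁ prev x (ρ Fin.zero))
    RunCondition-zero = mk⇔ (λ { (inj₁ (_ , (_ , () , _) , _)) ; (inj₂ (_ , d)) → d })
                          (λ d → inj₂ ((λ { _ (_ , () , _) }) , d))

    𝓛ᴮ⇔Accepting : ∀ w → 𝓛ᴮ Σ̃ B w ⇔ (∃[ q ] Accepting QI F q (localB q) (toList w))
    𝓛ᴮ⇔Accepting w@(x ∷⁺ xs) = mk⇔ to from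
      where
      to : 𝓛ᴮ Σ̃ B w → ∃[ q ] Accepting QI F q (localB q) (toList w)
      to (ρ , ((q₀ , init , d₀) , runs) , fin) = q , init , everywhere , subst (T ∘ F) final fin
        where
        q : ℕ → Fin nQ
        q zero    = q₀
        q (suc m) = extend ρ q₀ m
        q≡ρ : ∀ i → q (suc (toℕ i)) ≡ ρ i
        q≡ρ = extend-toℕ ρ q₀
        transitions : ∀ j → RunCondition w ρ (q (toℕ j)) j
        transitions Fin.zero    = Equivalence.from RunCondition-zero d₀
        transitions (Fin.suc i) =
          subst (λ prev → RunCondition w ρ prev (Fin.suc i))
                (sym (trans (cong (q ∘ suc) (sym (toℕ-inject₁ i))) (q≡ρ (inject₁ i)))) (runs i)
        everywhere : Everywhere (localB q) (toList w)
        everywhere j = Equivalence.to (RunCondition⇔localB q ρ q≡ρ j) (transitions j)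
        final : ρ (fromℕ (length xs)) ≡ q (suc (length xs))
        final = trans (sym (q≡ρ (fromℕ (length xs)))) (cong (q ∘ suc) (toℕ-fromℕ (length xs)))
      from : ∃[ q ] Accepting QI F q (localB q) (toList w) → 𝓛ᴮ Σ̃ B w
      from (q , init , everywhere , fin) =
        ρ , ((q 0 , init , Equivalence.to RunCondition-zero (transitions Fin.zero)) ,
             λ i → subst (λ prev → RunCondition w ρ prev (Fin.suc i))
                         (cong (q ∘ suc) (sym (toℕ-inject₁ i))) (transitions (Fin.suc i))) ,
        subst (T ∘ F ∘ q ∘ suc) (sym (toℕ-fromℕ (length xs))) fin
        where
        ρ : Pos Σ̃ w → Fin nQ
        ρ i = q (suc (toℕ i))
        transitions : ∀ j → RunCondition w ρ (q (toℕ j)) j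
        transitions j = Equivalence.from (RunCondition⇔localB q ρ (λ _ → refl) j) (everywhere j)

  -- The two simulations

  module FromMNWA (B : MNWA Σ̃) where
    open MNWA B
    open MNWARuns B

    -- Calls push the state they reach.
    A : MVPA Σ̃
    A = record { nQ = nQ ; nG = nQ
               ; δc = λ q a G q′ → ⌊ G ≟ q′ ⌋ ∧ δ₁ q a q′
               ; δr = transition ; δint = δ₁ ; QI = QI ; F = F }
    open MVPARuns A

    T-δc : ∀ {q a G q′} → T (⌊ G ≟ q′ ⌋ ∧ δ₁ q a q′) ⇔ (G ≡ q′ × T (δ₁ q a q′))
    T-δc {G = G} {q′} with G ≟ q′
    ... | yes G≡q′ = mk⇔ (G≡q′ ,_) proj₂
    ... | no  G≢q′ = mk⇔ ⊥-elim (⊥-elim ∘ G≢q′ ∘ proj₁)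

    localB⇒localA : ∀ {q p S} a → localB q p S a → localA q (just ∘ q ∘ suc) p S a
    localB⇒localA {q} {p} {S} a l with kind a
    ... | call _ = q (suc p) , refl , Equivalence.from T-δc (refl , l)
    ... | int    = l
    ... | ret s with head (S s)
    ...   | just _  = l
    ...   | nothing = l

    pushes-reached : ∀ {w q γ} → Everywhere (localA q γ) (toList w) →
      ∀ {j k} → matchingCall (pendingAt w j) (label Σ̃ w j) ≡ just k → γ k ≡ just (q (suc k))
    pushes-reached {w} everywhere {j} eq with matchingCall⇒μ {w} {j} eq
    ... | i , refl , (_ , _ , ki , _ , _) with localA-call ki (everywhere i)
    ...   | G , γi , d = trans γi (cong just (proj₁ (Equivalence.to T-δc d)))

    localA⇒localB : ∀ {w q γ} → Everywhere (localA q γ) (toList w) → Everywhere (localB q) (toList w)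
    localA⇒localB {w} {q} {γ} everywhere j with kind (label Σ̃ w j) in kj | everywhere j
    ... | call _ | _ , _ , d = proj₂ (Equivalence.to T-δc d)
    ... | int    | l = l
    ... | ret s  | l with head (pendingAt w j s) in top
    ...   | nothing = l
    ...   | just k  = subst (λ g → T (transition (q (toℕ j)) (label Σ̃ w j) g (q (suc (toℕ j)))))
                            (pushes-reached {w} everywhere {j} (trans (matchingCall-ret kj) top)) l

    accepts-same : ∀ w → 𝓛ᴮ Σ̃ B w ⇔ 𝓛ᴬ Σ̃ A w
    accepts-same w = ⇔-sym (𝓛ᴬ⇔Accepting w) ⇔-∘ (mk⇔ fromB toB ⇔-∘ 𝓛ᴮ⇔Accepting w)
      where
      fromB : ∃[ q ] Accepting QI F q (localB q) (toList w) →
              ∃[ q ] ∃[ γ ] Accepting QI F q (localA q γ) (toList w)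
      fromB (q , init , everywhere , fin) =
        q , just ∘ q ∘ suc , init , (λ j → localB⇒localA (label Σ̃ w j) (everywhere j)) , fin
      toB : ∃[ q ] ∃[ γ ] Accepting QI F q (localA q γ) (toList w) →
            ∃[ q ] Accepting QI F q (localB q) (toList w)
      toB (q , γ , init , everywhere , fin) = q , init , localA⇒localB {w} everywhere , fin

  module FromMVPA (A : MVPA Σ̃) where
    open MVPA A
    open MVPARuns A

    -- A state of B is a state of A together with the symbol pushed on entering it, if any.
    State : Set
    State = Fin (nQ * suc nG)

    code : State ↔ (Fin nQ × Fin (suc nG))
    code = *↔×

    stateᴬ : State → Fin nQ
    stateᴬ = proj₁ ∘ Inverse.to code

    pushedᴬ : State → Maybe (Fin nG)
    pushedᴬ = toMaybe ∘ proj₂ ∘ Inverse.to code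

    encode : Fin nQ → Maybe (Fin nG) → State
    encode q g = Inverse.from code (q , fromMaybe g)

    stateᴬ-encode : ∀ q g → stateᴬ (encode q g) ≡ q
    stateᴬ-encode q g = cong proj₁ (Inverse.strictlyInverseˡ code (q , fromMaybe g))

    pushedᴬ-encode : ∀ q g → pushedᴬ (encode q g) ≡ g
    pushedᴬ-encode q g = trans (cong (toMaybe ∘ proj₂) (Inverse.strictlyInverseˡ code (q , fromMaybe g)))
                               (toMaybe-fromMaybe g)

    onCall : Fin nQ → Letter → Maybe (Fin nG) → Fin nQ → Bool
    onCall q a (just G) q′ = δc q a G q′
    onCall q a nothing  q′ = false

    δ₁ᴮ : State → Letter → State → Bool
    δ₁ᴮ x a y with kind a
    ... | call _ = onCall (stateᴬ x) a (pushedᴬ y) (stateᴬ y)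
    ... | ret _  = δr (stateᴬ x) a nothing (stateᴬ y)
    ... | int    = δint (stateᴬ x) a (stateᴬ y)

    B : MNWA Σ̃
    B = record { nQ = nQ * suc nG
               ; δ₁ = δ₁ᴮ
               ; δ₂ = λ h x a y → δr (stateᴬ x) a (pushedᴬ h) (stateᴬ y)
               ; QI = QI ∘ stateᴬ ; F = F ∘ stateᴬ }
    open MNWARuns B

    T-onCall : ∀ {q a g q′} → T (onCall q a g q′) ⇔ (∃[ G ] (g ≡ just G × T (δc q a G q′)))
    T-onCall {g = just G} = mk⇔ (λ t → G , refl , t) (λ { (_ , refl , t) → t })
    T-onCall {g = nothing} = mk⇔ ⊥-elim (λ { (_ , () , _) })

    localB⇔localA : ∀ {qB q γ} → (∀ m → stateᴬ (qB m) ≡ q m) → (∀ p → pushedᴬ (qB (suc p)) ≡ γ p) →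
      ∀ {p S} a → localB qB p S a ⇔ localA q γ p S a
    localB⇔localA {qB} {q} {γ} hs hp {p} {S} a with kind a in ka
    ... | call _ rewrite ka | hs p | hs (suc p) | hp p = T-onCall
    ... | int    rewrite ka | hs p | hs (suc p) = ⇔-id _
    ... | ret s with head (S s)
    ...   | just k  rewrite hs p | hs (suc p) | hp k = ⇔-id _
    ...   | nothing rewrite ka | hs p | hs (suc p) = ⇔-id _

    accepts-same : ∀ w → 𝓛ᴬ Σ̃ A w ⇔ 𝓛ᴮ Σ̃ B w
    accepts-same w = ⇔-sym (𝓛ᴮ⇔Accepting w) ⇔-∘ (mk⇔ toB fromB ⇔-∘ 𝓛ᴬ⇔Accepting w)
      where
      ws = toList w
      fromB : ∃[ qB ] Accepting (QI ∘ stateᴬ) (F ∘ stateᴬ) qB (localB qB) ws →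
              ∃[ q ] ∃[ γ ] Accepting QI F q (localA q γ) ws
      fromB (qB , init , everywhere , fin) =
        stateᴬ ∘ qB , pushedᴬ ∘ qB ∘ suc , init ,
        (λ j → Equivalence.to (localB⇔localA (λ _ → refl) (λ _ → refl) (lookup ws j)) (everywhere j)) , fin
      toB : ∃[ q ] ∃[ γ ] Accepting QI F q (localA q γ) ws →
            ∃[ qB ] Accepting (QI ∘ stateᴬ) (F ∘ stateᴬ) qB (localB qB) ws
      toB (q , γ , init , everywhere , fin) =
        qB , subst (T ∘ QI) (sym (hs 0)) init ,
        (λ j → Equivalence.from (localB⇔localA hs hp (lookup ws j)) (everywhere j)) ,
        subst (T ∘ F) (sym (hs (length ws))) fin
        where
        pushedOnEntry : ℕ → Maybe (Fin nG)
        pushedOnEntry zero    = nothing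
        pushedOnEntry (suc p) = γ p
        qB : ℕ → State
        qB m = encode (q m) (pushedOnEntry m)
        hs : ∀ m → stateᴬ (qB m) ≡ q m
        hs m = stateᴬ-encode (q m) (pushedOnEntry m)
        hp : ∀ p → pushedᴬ (qB (suc p)) ≡ γ p
        hp p = pushedᴬ-encode (q (suc p)) (γ p)

lemma2p8 : (Σ̃ : Alphabet) (L : NestedWord Σ̃ → Set) →
    (∃[ A ] (∀ w → 𝓛ᴬ Σ̃ A w ⇔ L w)) ⇔ (∃[ B ] (∀ w → 𝓛ᴮ Σ̃ B w ⇔ L w))
lemma2p8 Σ̃ L = mk⇔ toMNWA toMVPA
  where
  toMNWA : ∃[ A ] (∀ w → 𝓛ᴬ Σ̃ A w ⇔ L w) → ∃[ B ] (∀ w → 𝓛ᴮ Σ̃ B w ⇔ L w)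
  toMNWA (A , L≡) = FromMVPA.B Σ̃ A , λ w → L≡ w ⇔-∘ ⇔-sym (FromMVPA.accepts-same Σ̃ A w)
  toMVPA : ∃[ B ] (∀ w → 𝓛ᴮ Σ̃ B w ⇔ L w) → ∃[ A ] (∀ w → 𝓛ᴬ Σ̃ A w ⇔ L w)
  toMVPA (B , L≡) = FromMNWA.A Σ̃ B , λ w → L≡ w ⇔-∘ ⇔-sym (FromMNWA.accepts-same Σ̃ B w)
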